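{- Let $A,B,\gamma\ge 0$ and let $\{f_{m,n}\}_{m,n\ge0}$ be defined by $f_{m,n}=A^mB^n$ if $mn=0$ (with $0^0=1$), and $f_{m,n}=f_{m-1,n}+f_{m,n-1}+\gamma f_{m-1,n-1}$ if $mn>0$. Then $f_{m,n}=A^mB^n$ for every $m,n\ge 0$ if and only if $AB=A+B+\gamma$. -}

module Defs where

open import Level using (Level)
open import Data.Nat using (ℕ) renaming (zero to z; suc to s)
open import Algebra.Bundles using (CommutativeSemiring)
import Algebra.Definitions.RawSemiring as RS

module _ {c ℓ : Level} (R : CommutativeSemiring c ℓ) where
  open CommutativeSemiring R
  open RS rawSemiring using (_^_)

  f : Carrier → Carrier → Carrier → ℕ → ℕ → Carrier
  f A B γ z    n       = (A ^ z) * (B ^ n)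
  f A B γ (s m) z    = (A ^ s m) * (B ^ z)
  f A B γ (s m) (s n) = f A B γ m (s n) + f A B γ (s m) n + γ * f A B γ m n

{-# OPTIONS --safe #-}
-- Necessity is the recurrence at (1, 1), which reads f₁₁ = A + B + γ. For sufficiency, the
-- monomials A^m B^n have the right boundary values and satisfy the recurrence, since
-- A^m B^(n+1) + A^(m+1) B^n + γ A^m B^n = A^m B^n (A + B + γ) = A^m B^n · AB.
module Submission where

open import Defs
open import Level using (Level)
open import Data.Nat using (ℕ; zero; suc)
open import Data.Product using (_×_; _,_)
open import Algebra.Bundles using (CommutativeSemiring)
import Algebra.Definitions.RawSemiring as RS
import Algebra.Solver.Ring.NaturalCoefficients.Default as Solver
import Relation.Binary.Reasoning.Setoid as SetoidReasoning

module _ {c ℓ : Level} (R : CommutativeSemiring c ℓ) where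
  open CommutativeSemiring R
  open RS rawSemiring using (_^_)
  open Solver R
  open SetoidReasoning setoid

  module _ (A B γ : Carrier) where

    monomial : ℕ → ℕ → Carrier
    monomial m n = A ^ m * B ^ n

    monomial-one-one : monomial 1 1 ≈ A * B
    monomial-one-one = solve 2 (λ a b → (a :* con 1) :* (b :* con 1) := a :* b) refl A B

    f-one-one : f R A B γ 1 1 ≈ A + B + γ
    f-one-one =
      solve 3 (λ a b g → con 1 :* (b :* con 1) :+ (a :* con 1) :* con 1 :+ g :* (con 1 :* con 1)
                         := a :+ b :+ g)
            refl A B γ

    monomial-recurrence-factor : ∀ m n →
      monomial m (suc n) + monomial (suc m) n + γ * monomial m n ≈ monomial m n * (A + B + γ)
    monomial-recurrence-factor m n =
      solve 5 (λ x y a b g → x :* (b :* y) :+ (a :* x) :* y :+ g :* (x :* y) := (x :* y) :* (a :+ b :+ g))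
            refl (A ^ m) (B ^ n) A B γ

    monomial-diagonal-step : ∀ m n → monomial m n * (A * B) ≈ monomial (suc m) (suc n)
    monomial-diagonal-step m n =
      solve 4 (λ x y a b → (x :* y) :* (a :* b) := (a :* x) :* (b :* y)) refl (A ^ m) (B ^ n) A B

    monomial-recurrence : A * B ≈ A + B + γ → ∀ m n →
      monomial m (suc n) + monomial (suc m) n + γ * monomial m n ≈ monomial (suc m) (suc n)
    monomial-recurrence AB≈A+B+γ m n = begin
      monomial m (suc n) + monomial (suc m) n + γ * monomial m n ≈⟨ monomial-recurrence-factor m n ⟩
      monomial m n * (A + B + γ)                                 ≈⟨ *-congˡ AB≈A+B+γ ⟨
      monomial m n * (A * B)                                     ≈⟨ monomial-diagonal-step m n ⟩
      monomial (suc m) (suc n)                                   ∎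

    f≈monomial : A * B ≈ A + B + γ → ∀ m n → f R A B γ m n ≈ monomial m n
    f≈monomial AB≈A+B+γ zero    n       = refl
    f≈monomial AB≈A+B+γ (suc m) zero    = refl
    f≈monomial AB≈A+B+γ (suc m) (suc n) = begin
      f R A B γ m (suc n) + f R A B γ (suc m) n + γ * f R A B γ m n
        ≈⟨ +-cong (+-cong (f≈monomial AB≈A+B+γ m (suc n)) (f≈monomial AB≈A+B+γ (suc m) n))
                  (*-congˡ (f≈monomial AB≈A+B+γ m n)) ⟩
      monomial m (suc n) + monomial (suc m) n + γ * monomial m n
        ≈⟨ monomial-recurrence AB≈A+B+γ m n ⟩
      monomial (suc m) (suc n) ∎

    f≈monomial⇒AB≈A+B+γ : (∀ m n → f R A B γ m n ≈ monomial m n) → A * B ≈ A + B + γ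
    f≈monomial⇒AB≈A+B+γ f≈m = begin
      A * B         ≈⟨ monomial-one-one ⟨
      monomial 1 1  ≈⟨ f≈m 1 1 ⟨
      f R A B γ 1 1 ≈⟨ f-one-one ⟩
      A + B + γ     ∎

proposition4p1 : {c ℓ : Level} (R : CommutativeSemiring c ℓ) →
    let open CommutativeSemiring R in
    let open RS rawSemiring using (_^_) in
    (A B γ : Carrier) →
    ((∀ (m n : ℕ) → f R A B γ m n ≈ (A ^ m) * (B ^ n)) → A * B ≈ A + B + γ)
    × (A * B ≈ A + B + γ → ∀ (m n : ℕ) → f R A B γ m n ≈ (A ^ m) * (B ^ n))
proposition4p1 R A B γ = f≈monomial⇒AB≈A+B+γ R A B γ , f≈monomial R A B γ
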